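{- Let $\lambda$ be a lifting operator, assigning to every relation $\beta:Y\rightharpoonup\wp(Z)$ a relation $\lambda(\beta):\wp(Y)\rightharpoonup\wp(Z)$, and define $\alpha\bullet\beta=\alpha\lambda(\beta)$. For any set $X$ and relation $\iota_X:X\rightharpoonup\wp(X)$, the following are equivalent: (i) $\lambda(\iota_X)=\mathrm{id}_{\wp(X)}$ and $\iota_X\lambda(\alpha)=\alpha$ for every set $Y$ and every relation $\alpha:X\rightharpoonup\wp(Y)$; (ii) $\iota_X$ is the identity on $X$ for $\bullet$, i.e. $\delta\bullet\iota_X=\delta$ for all $\delta:W\rightharpoonup\wp(X)$ and $\iota_X\bullet\alpha=\alpha$ for all $\alpha:X\rightharpoonup\wp(Y)$.
   Context: A relation $\alpha:X\rightharpoonup Y$ is a subset of $X\times Y$; juxtaposition denotes relational composition; $\mathrm{id}_X$ is the identity relation on $X$. -}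

module Defs where

open import Data.Product using (Σ; _×_)
open import Function.Bundles using (_⇔_)
open import Relation.Binary.PropositionalEquality using (_≡_)

-- "Sets" are types in Set₁; subsets are Set-valued predicates, so the
-- universe of sets is closed under the powerset construction.
℘ : Set₁ → Set₁
℘ X = X → Set

Rel : Set₁ → Set₁ → Set₂
Rel A B = A → B → Set₁

-- Relational composition (diagrammatic order, written by juxtaposition in the paper).
_⨾_ : {A B C : Set₁} → Rel A B → Rel B C → Rel A C
(α ⨾ β) a c = Σ _ (λ b → α a b × β b c)

idR : (A : Set₁) → Rel A A
idR A a a′ = a ≡ a′

_≐_ : {A B : Set₁} → Rel A B → Rel A B → Set₁
R ≐ S = ∀ a b → R a b ⇔ S a b

Lifting : Set₂
Lifting = (Y Z : Set₁) → Rel Y (℘ Z) → Rel (℘ Y) (℘ Z)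

bullet : Lifting → {X Y Z : Set₁} → Rel X (℘ Y) → Rel Y (℘ Z) → Rel X (℘ Z)
bullet lift {Y = Y} {Z = Z} α β = α ⨾ lift Y Z β

module Submission where

open import Defs
open import Data.Product using (_×_; _,_)
open import Function.Bundles using (_⇔_; mk⇔; Equivalence)
import Function.Properties.Equivalence as ⇔
open import Relation.Binary.PropositionalEquality using (refl)

open Equivalence

≐-sym : {A B : Set₁} {R S : Rel A B} → R ≐ S → S ≐ R
≐-sym e a b = ⇔.sym (e a b)

≐-trans : {A B : Set₁} {R S T : Rel A B} → R ≐ S → S ≐ T → R ≐ T
≐-trans e f a b = ⇔.trans (e a b) (f a b)

⨾-congˡ : {A B C : Set₁} (δ : Rel A B) {R S : Rel B C} → R ≐ S → (δ ⨾ R) ≐ (δ ⨾ S)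
⨾-congˡ δ e a c = mk⇔ (λ { (b , p , q) → b , p , to (e b c) q })
                      (λ { (b , p , q) → b , p , from (e b c) q })

⨾-identityʳ : {A B : Set₁} (δ : Rel A B) → (δ ⨾ idR B) ≐ δ
⨾-identityʳ δ a b = mk⇔ (λ { (_ , p , refl) → p }) (λ p → b , p , refl)

⨾-identityˡ : {A B : Set₁} (δ : Rel A B) → (idR A ⨾ δ) ≐ δ
⨾-identityˡ δ a b = mk⇔ (λ { (_ , refl , p) → p }) (λ p → a , refl , p)

-- The left-unit law for ι with δ = id on ℘(X) says exactly λ(ι) ≐ id.
lift-identity⇔bullet-identityʳ : (lift : Lifting) (X : Set₁) (ι : Rel X (℘ X)) →
  lift X X ι ≐ idR (℘ X) ⇔ ((W : Set₁) (δ : Rel W (℘ X)) → bullet lift δ ι ≐ δ)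
lift-identity⇔bullet-identityʳ lift X ι = mk⇔
  (λ liftι≐id W δ → ≐-trans (⨾-congˡ δ liftι≐id) (⨾-identityʳ δ))
  (λ δ•ι≐δ → ≐-trans (≐-sym (⨾-identityˡ (lift X X ι))) (δ•ι≐δ (℘ X) (idR (℘ X))))

corollary3p3 : (lift : Lifting) (X : Set₁) (ι : Rel X (℘ X)) →
    ((lift X X ι ≐ idR (℘ X)) × ((Y : Set₁) (α : Rel X (℘ Y)) → (ι ⨾ lift X Y α) ≐ α))
    ⇔ (((W : Set₁) (δ : Rel W (℘ X)) → bullet lift δ ι ≐ δ)
    × ((Y : Set₁) (α : Rel X (℘ Y)) → bullet lift ι α ≐ α))
corollary3p3 lift X ι = mk⇔
  (λ { (liftι≐id , ι•α≐α) → to unitʳ liftι≐id , ι•α≐α })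
  (λ { (δ•ι≐δ , ι•α≐α) → from unitʳ δ•ι≐δ , ι•α≐α })
  where
  unitʳ : lift X X ι ≐ idR (℘ X) ⇔ ((W : Set₁) (δ : Rel W (℘ X)) → bullet lift δ ι ≐ δ)
  unitʳ = lift-identity⇔bullet-identityʳ lift X ι
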